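{- Let $\mathcal{S}_1=\{\emptyset\}\cup\{F\subseteq\omega\setminus\{0\}\colon F\text{ finite nonempty},\ |F|\le\min(F)\}$, let $\lambda=(\lambda_k)_{k\ge1}$ with $\lambda_k=2^{ -n}$ for $k\in[2^n,2^{n+1})$, and let $\varphi_1(A)=\sup\{\sum_{i\in A\cap F}\lambda_i\colon F\in\mathcal{S}_1\}$ for $A\subseteq\omega\setminus\{0\}$. Then \[\mathcal{I}_1:=\{A\subseteq\omega\setminus\{0\}\colon\lim_{n\to\infty}\varphi_1(A\setminus n)=0\}=\mathcal{Z},\] where $\mathcal{Z}=\{A\subseteq\omega\setminus\{0\}\colon|A\cap[1,n]|/n\to0\}$ is the density zero ideal. -}

module Defs where

open import Data.Bool using (Bool; true; false; _∧_; if_then_else_)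
open import Data.Nat using (ℕ; zero; suc; _^_; _≤ᵇ_) renaming (_≤_ to _≤ℕ_; _+_ to _+ℕ_)
open import Data.Nat.Properties using (m^n≢0)
open import Data.Nat.Logarithm using (⌊log₂_⌋)
open import Data.Integer using (+_)
open import Data.Rational using (ℚ; 0ℚ; _/_; _+_; _≤_; _<_)
open import Data.List using (List; []; _∷_; length; filter; map; foldr)
open import Data.List.Relation.Unary.All using (All)
open import Data.List.Relation.Unary.Unique.Propositional using (Unique)
open import Data.Product using (_×_; ∃)
open import Relation.Binary.PropositionalEquality using (_≡_)
open import Data.Bool.Properties using (_≟_)

-- Subsets of ω∖{0} are represented by their characteristic functions ℕ → Bool
-- (the value at 0 is ignored by all notions below).
Subset : Set
Subset = ℕ → Bool

-- F ∈ 𝒮₁ : F is a finite set (duplicate-free list) of positive naturals with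
-- |F| ≤ min F, i.e. |F| ≤ x for every x ∈ F.  The empty list is ∅ ∈ 𝒮₁.
S₁ : List ℕ → Set
S₁ F = Unique F × All (λ x → (1 ≤ℕ x) × (length F ≤ℕ x)) F

lam : ℕ → ℚ
lam k = (+ 1 / (2 ^ ⌊log₂ k ⌋)) {{m^n≢0 2 ⌊log₂ k ⌋}}

sumℚ : List ℚ → ℚ
sumℚ = foldr _+_ 0ℚ

tailSum : Subset → ℕ → List ℕ → ℚ
tailSum A n F = sumℚ (map lam (filter (λ i → (A i ∧ (n ≤ᵇ i)) ≟ true) F))

-- A ∈ ℐ₁ : lim_n φ₁(A ∖ n) = 0, where φ₁(A∖n) = sup_{F ∈ 𝒮₁} tailSum A n F.
-- φ₁ ≥ 0, so the limit statement reads: ∀ ε > 0 ∃ N ∀ n ≥ N, φ₁(A∖n) ≤ ε,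
-- and φ₁(A∖n) ≤ ε unfolds to ∀ F ∈ 𝒮₁, tailSum A n F ≤ ε.
I₁ : Subset → Set
I₁ A = ∀ (ε : ℚ) → 0ℚ < ε → ∃ λ N → ∀ n → N ≤ℕ n → ∀ F → S₁ F → tailSum A n F ≤ ε

count : Subset → ℕ → ℕ
count A zero = 0
count A (suc n) = (if A (suc n) then 1 else 0) +ℕ count A n

-- |A ∩ [1, m]| / m, evaluated at m = suc n
density : Subset → ℕ → ℚ
density A n = + count A (suc n) / suc n

-- A ∈ 𝒵 : |A ∩ [1,m]| / m → 0 (values are ≥ 0)
Z : Subset → Set
Z A = ∀ (ε : ℚ) → 0ℚ < ε → ∃ λ N → ∀ n → N ≤ℕ n → density A n ≤ ε

module Submission where

-- The weight λ_x = 2^-⌊log₂ x⌋ lies in [1/x, 2/x).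
--
-- Z ⊆ ℐ₁: suppose |A ∩ [1,t]| ≤ t/16q² for all t > n, and let G = F ∩ (A ∖ n) for some
-- F ∈ 𝒮₁, so that g = |G| ≤ min G. Put D = 4qg. Elements of G that are at least D weigh less
-- than 2/D each, hence at most 2g/D = 1/2q together. If D ≤ n there are no others; otherwise
-- there are at most D/16q² = g/4q of them, each weighing less than 2/g. So φ₁(A ∖ n) ≤ 1/q.
--
-- ℐ₁ ⊆ Z: if |A ∩ [1,k]| > k/q, let M = ⌊k/2q⌋ ≥ 1. More than 2M elements of A lie in [1,k],
-- so at least M of them lie in [M,k]; M of these form a set in 𝒮₁ whose λ-sum is at least
-- M/k > 1/4q. Hence φ₁(A ∖ M) ≤ 1/4q for all large M bounds the density by 1/q.

open import Defs
open import Data.Bool using (true; false; _∧_; if_then_else_)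
open import Data.Bool.Properties using (T-≡; T-∧) renaming (_≟_ to _≟ᵇ_)
open import Data.Integer as ℤ using (+_; +≤+)
import Data.Integer.Properties as ℤ
open import Data.Integer.Solver using (module +-*-Solver)
open import Data.List using (List; []; _∷_; length; filter; map; take; downFrom)
open import Data.List.Properties
  using (length-filter; length-take; filter-all; filter-none; filter-accept; filter-reject)
open import Data.List.Relation.Unary.All as All using (All; []; _∷_)
open import Data.List.Relation.Unary.All.Properties using (all-filter; applyDownFrom⁺₁)
  renaming (filter⁺ to All-filter⁺; take⁺ to All-take⁺; map⁺ to All-map⁺)
open import Data.List.Relation.Unary.Unique.Propositional using (Unique; []; _∷_)
open import Data.List.Relation.Unary.Unique.Propositional.Properties using (downFrom⁺)
  renaming (filter⁺ to Unique-filter⁺; take⁺ to Unique-take⁺; map⁺ to Unique-map⁺)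
open import Data.Nat
  using (ℕ; zero; suc; NonZero; >-nonZero; >-nonZero⁻¹; z≤n; s≤s; s≤s⁻¹; _+_; _*_; _^_; _≤_; _<_; ⌊_/2⌋; _≤ᵇ_; _<?_; _≤?_)
open import Data.Nat.DivMod using (_/_; _%_; m≡m%n+[m/n]*n; m%n<n; m/n*n≤m; m*n/n≡m; /-monoˡ-≤)
open import Data.Nat.ListAction using (sum)
open import Data.Nat.Logarithm using (⌊log₂_⌋)
open import Data.Nat.Logarithm.Core using (⌊log2⌋)
open import Data.Nat.Properties
open import Data.Nat.Solver using () renaming (module +-*-Solver to ℕ-Solver)
open import Data.Product using (_×_; _,_; proj₁; proj₂; ∃)
open import Data.Rational as ℚ using (ℚ; mkℚ; 0ℚ; toℚᵘ)
import Data.Rational.Properties as ℚ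
open import Data.Rational.Unnormalised as ℚᵘ using (mkℚᵘ; *≤*; *≡*)
import Data.Rational.Unnormalised.Properties as ℚᵘ
open import Function.Base using (_∘_)
open import Function.Bundles using (_⇔_; mk⇔; Equivalence)
open import Induction.WellFounded using (acc)
open import Relation.Binary.PropositionalEquality
open import Relation.Nullary using (Dec; ¬_; ¬?; yes; no; does; contradiction)
open import Relation.Nullary.Reflects using (ofʸ; ofⁿ)
open import Relation.Unary using (Decidable)

private
  toℚᵘ-/ : ∀ a b → toℚᵘ (+ a ℚ./ suc b) ℚᵘ.≃ mkℚᵘ (+ a) b
  toℚᵘ-/ a b = ℚ.toℚᵘ-fromℚᵘ (mkℚᵘ (+ a) b)

*≤*⇒/≤/ : ∀ a b c d .{{_ : NonZero b}} .{{_ : NonZero d}} →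
          a * d ≤ c * b → + a ℚ./ b ℚ.≤ + c ℚ./ d
*≤*⇒/≤/ a (suc b) c (suc d) ad≤cb = ℚ.toℚᵘ-cancel-≤
  (ℚᵘ.≤-respˡ-≃ (ℚᵘ.≃-sym (toℚᵘ-/ a b)) (ℚᵘ.≤-respʳ-≃ (ℚᵘ.≃-sym (toℚᵘ-/ c d))
    (*≤* (subst₂ ℤ._≤_ (ℤ.pos-* a (suc d)) (ℤ.pos-* c (suc b)) (+≤+ ad≤cb)))))

/≤/⇒*≤* : ∀ a b c d .{{_ : NonZero b}} .{{_ : NonZero d}} →
          + a ℚ./ b ℚ.≤ + c ℚ./ d → a * d ≤ c * b
/≤/⇒*≤* a (suc b) c (suc d) a/b≤c/d
  with ℚᵘ.≤-respˡ-≃ (toℚᵘ-/ a b) (ℚᵘ.≤-respʳ-≃ (toℚᵘ-/ c d) (ℚ.toℚᵘ-mono-≤ a/b≤c/d))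
... | *≤* ad≤cb = ℤ.drop‿+≤+ (subst₂ ℤ._≤_ (sym (ℤ.pos-* a (suc d))) (sym (ℤ.pos-* c (suc b))) ad≤cb)

/-distribʳ-+ : ∀ a b d .{{_ : NonZero d}} → + (a + b) ℚ./ d ≡ + a ℚ./ d ℚ.+ + b ℚ./ d
/-distribʳ-+ a b (suc d) = ℚ.toℚᵘ-injective (begin-equality
  toℚᵘ (+ (a + b) ℚ./ D)                        ≃⟨ toℚᵘ-/ (a + b) d ⟩
  mkℚᵘ (+ (a + b)) d                            ≃⟨ *≡* cross ⟨
  mkℚᵘ (+ a) d ℚᵘ.+ mkℚᵘ (+ b) d                ≃⟨ ℚᵘ.+-cong (toℚᵘ-/ a d) (toℚᵘ-/ b d) ⟨
  toℚᵘ (+ a ℚ./ D) ℚᵘ.+ toℚᵘ (+ b ℚ./ D)        ≃⟨ ℚ.toℚᵘ-homo-+ (+ a ℚ./ D) (+ b ℚ./ D) ⟨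
  toℚᵘ (+ a ℚ./ D ℚ.+ + b ℚ./ D)                ∎)
  where
  open ℚᵘ.≤-Reasoning
  open +-*-Solver
  D = suc d
  cross : (+ a ℤ.* + D ℤ.+ + b ℤ.* + D) ℤ.* + D ≡ + (a + b) ℤ.* + (D * D)
  cross rewrite ℤ.pos-+ a b | ℤ.pos-* D D =
    solve 3 (λ x y z → (x :* z :+ y :* z) :* z := (x :+ y) :* (z :* z)) refl (+ a) (+ b) (+ D)

0<1/ : ∀ d .{{_ : NonZero d}} → 0ℚ ℚ.< + 1 ℚ./ d
0<1/ d = ℚ.positive⁻¹ (+ 1 ℚ./ d) {{ℚ.normalize-pos 1 d}}

∃1/suc≤ : ∀ {ε} → 0ℚ ℚ.< ε → ∃ λ q → + 1 ℚ./ suc q ℚ.≤ ε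
∃1/suc≤ {mkℚ (+ zero) _ _} (ℚ.*<* (ℤ.+<+ ()))
∃1/suc≤ {mkℚ ℤ.+[1+ k ] d _} _ = d , ℚ.toℚᵘ-cancel-≤ (ℚᵘ.≤-respˡ-≃ (ℚᵘ.≃-sym (toℚᵘ-/ 1 d))
  (*≤* (ℤ.*-monoʳ-≤-nonNeg (+ suc d) {+ 1} {+ suc k} (+≤+ (s≤s z≤n)))))
∃1/suc≤ {mkℚ ℤ.-[1+ k ] _ _} (ℚ.*<* ())

sumℚ≤sum/d : ∀ {X : Set} (f : X → ℚ) (w : X → ℕ) d .{{_ : NonZero d}} {xs} →
           All (λ x → f x ℚ.≤ + w x ℚ./ d) xs → sumℚ (map f xs) ℚ.≤ + sum (map w xs) ℚ./ d
sumℚ≤sum/d f w d [] = *≤*⇒/≤/ 0 1 0 d z≤n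
sumℚ≤sum/d f w d {x ∷ xs} (fx≤ ∷ fxs≤) =
  subst (_ ℚ.≤_) (sym (/-distribʳ-+ (w x) (sum (map w xs)) d)) (ℚ.+-mono-≤ fx≤ (sumℚ≤sum/d f w d fxs≤))

length/d≤sumℚ : ∀ {X : Set} (f : X → ℚ) d .{{_ : NonZero d}} {xs} →
                 All (λ x → + 1 ℚ./ d ℚ.≤ f x) xs → + length xs ℚ./ d ℚ.≤ sumℚ (map f xs)
length/d≤sumℚ f d [] = *≤*⇒/≤/ 0 d 0 1 z≤n
length/d≤sumℚ f d {x ∷ xs} (≤fx ∷ ≤fxs) =
  subst (ℚ._≤ _) (sym (/-distribʳ-+ 1 (length xs) d)) (ℚ.+-mono-≤ ≤fx (length/d≤sumℚ f d ≤fxs))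

sum-if-≤ : ∀ {X : Set} {P : X → Set} (P? : Decidable P) a b xs →
           sum (map (λ x → if does (P? x) then a else b) xs) ≤ a * length (filter P? xs) + b * length xs
sum-if-≤ P? a b [] = z≤n
sum-if-≤ P? a b (x ∷ xs) with does (P? x)
... | true = begin
  a + sum (map w xs)       ≤⟨ +-monoʳ-≤ a (sum-if-≤ P? a b xs) ⟩
  a + (a * c + b * l)      ≤⟨ m≤m+n _ b ⟩
  a + (a * c + b * l) + b  ≡⟨ solve 4 (λ a b c l → a :+ (a :* c :+ b :* l) :+ b := a :* (con 1 :+ c) :+ b :* (con 1 :+ l)) refl a b c l ⟩
  a * suc c + b * suc l    ∎
  where
  open ≤-Reasoning
  open ℕ-Solver
  w = λ x → if does (P? x) then a else b
  c = length (filter P? xs)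
  l = length xs
... | false = begin
  b + sum (map w xs)       ≤⟨ +-monoʳ-≤ b (sum-if-≤ P? a b xs) ⟩
  b + (a * c + b * l)      ≡⟨ solve 4 (λ a b c l → b :+ (a :* c :+ b :* l) := a :* c :+ b :* (con 1 :+ l)) refl a b c l ⟩
  a * c + b * suc l        ∎
  where
  open ≤-Reasoning
  open ℕ-Solver
  w = λ x → if does (P? x) then a else b
  c = length (filter P? xs)
  l = length xs

⌊n/2⌋+⌊n/2⌋≤n : ∀ n → ⌊ n /2⌋ + ⌊ n /2⌋ ≤ n
⌊n/2⌋+⌊n/2⌋≤n 0 = z≤n
⌊n/2⌋+⌊n/2⌋≤n 1 = z≤n
⌊n/2⌋+⌊n/2⌋≤n (suc (suc n)) rewrite +-suc ⌊ n /2⌋ ⌊ n /2⌋ = s≤s (s≤s (⌊n/2⌋+⌊n/2⌋≤n n))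

n≤1+⌊n/2⌋+⌊n/2⌋ : ∀ n → n ≤ suc (⌊ n /2⌋ + ⌊ n /2⌋)
n≤1+⌊n/2⌋+⌊n/2⌋ 0 = z≤n
n≤1+⌊n/2⌋+⌊n/2⌋ 1 = s≤s z≤n
n≤1+⌊n/2⌋+⌊n/2⌋ (suc (suc n)) rewrite +-suc ⌊ n /2⌋ ⌊ n /2⌋ = s≤s (s≤s (n≤1+⌊n/2⌋+⌊n/2⌋ n))

2^⌊log2⌋n≤n : ∀ n {acc} → 1 ≤ n → 2 ^ ⌊log2⌋ n acc ≤ n
2^⌊log2⌋n≤n 1 _ = s≤s z≤n
2^⌊log2⌋n≤n (suc (suc m)) {acc rs} _ = begin
  2 * 2 ^ ⌊log2⌋ (suc h) (rs _)  ≤⟨ *-monoʳ-≤ 2 (2^⌊log2⌋n≤n (suc h) (s≤s z≤n)) ⟩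
  2 * suc h                      ≡⟨ solve 1 (λ h → con 2 :* (con 1 :+ h) := con 2 :+ (h :+ h)) refl h ⟩
  2 + (h + h)                    ≤⟨ +-monoʳ-≤ 2 (⌊n/2⌋+⌊n/2⌋≤n m) ⟩
  2 + m                          ∎
  where
  open ≤-Reasoning
  open ℕ-Solver
  h = ⌊ m /2⌋

n<2*2^⌊log2⌋n : ∀ n {acc} → n < 2 * 2 ^ ⌊log2⌋ n acc
n<2*2^⌊log2⌋n 0 = s≤s z≤n
n<2*2^⌊log2⌋n 1 = s≤s (s≤s z≤n)
n<2*2^⌊log2⌋n (suc (suc m)) {acc rs} = begin-strict
  2 + m                               ≤⟨ +-monoʳ-≤ 2 (n≤1+⌊n/2⌋+⌊n/2⌋ m) ⟩
  3 + (h + h)                         <⟨ n<1+n _ ⟩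
  4 + (h + h)                         ≡⟨ solve 1 (λ h → con 4 :+ (h :+ h) := con 2 :* (con 2 :+ h)) refl h ⟩
  2 * (2 + h)                         ≤⟨ *-monoʳ-≤ 2 (n<2*2^⌊log2⌋n (suc h)) ⟩
  2 * (2 * 2 ^ ⌊log2⌋ (suc h) (rs _))  ∎
  where
  open ≤-Reasoning
  open ℕ-Solver
  h = ⌊ m /2⌋

lam≤[2a]/D : ∀ x a D .{{_ : NonZero D}} → D ≤ a * x → lam x ℚ.≤ + (2 * a) ℚ./ D
lam≤[2a]/D x a D D≤ax = *≤*⇒/≤/ 1 (2 ^ ⌊log₂ x ⌋) (2 * a) D {{m^n≢0 2 ⌊log₂ x ⌋}} (begin
  1 * D                    ≡⟨ *-identityˡ D ⟩
  D                        ≤⟨ D≤ax ⟩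
  a * x                    ≤⟨ *-monoʳ-≤ a (<⇒≤ (n<2*2^⌊log2⌋n x)) ⟩
  a * (2 * 2 ^ ⌊log₂ x ⌋)  ≡⟨ solve 2 (λ a p → a :* (con 2 :* p) := con 2 :* a :* p) refl a (2 ^ ⌊log₂ x ⌋) ⟩
  2 * a * 2 ^ ⌊log₂ x ⌋    ∎)
  where
  open ≤-Reasoning
  open ℕ-Solver

1/k≤lam : ∀ x k .{{_ : NonZero k}} → 1 ≤ x → x ≤ k → + 1 ℚ./ k ℚ.≤ lam x
1/k≤lam x k {{k≢0}} 1≤x x≤k = *≤*⇒/≤/ 1 k 1 (2 ^ ⌊log₂ x ⌋) {{k≢0}} {{m^n≢0 2 ⌊log₂ x ⌋}}
  (subst₂ _≤_ (sym (*-identityˡ (2 ^ ⌊log₂ x ⌋))) (sym (*-identityˡ k)) (≤-trans (2^⌊log2⌋n≤n x 1≤x) x≤k))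

count≤n : ∀ A n → count A n ≤ n
count≤n A zero = z≤n
count≤n A (suc n) with A (suc n)
... | true  = s≤s (count≤n A n)
... | false = m≤n⇒m≤1+n (count≤n A n)

length≤1+length-filter-≢ : ∀ m {xs : List ℕ} → Unique xs →
                           length xs ≤ suc (length (filter (λ y → ¬? (y ≟ m)) xs))
length≤1+length-filter-≢ m [] = z≤n
length≤1+length-filter-≢ m {x ∷ xs} (x∉xs ∷ xs-unique) with x ≟ m
... | yes refl
  rewrite filter-reject (λ y → ¬? (y ≟ x)) {x} {xs} (λ x≢x → x≢x refl)
        | filter-all (λ y → ¬? (y ≟ x)) (All.map (λ x≢y y≡x → x≢y (sym y≡x)) x∉xs) = ≤-refl
... | no x≢m
  rewrite filter-accept (λ y → ¬? (y ≟ m)) {x} {xs} x≢m = s≤s (length≤1+length-filter-≢ m xs-unique)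

length≤count : ∀ A M xs → Unique xs → All (λ x → A x ≡ true × 1 ≤ x × x ≤ M) xs → length xs ≤ count A M
length≤count A zero [] _ _ = z≤n
length≤count A zero (x ∷ _) _ ((_ , 1≤x , x≤0) ∷ _) = contradiction (≤-trans 1≤x x≤0) λ ()
length≤count A (suc M) xs xs-unique xs-bounded with A (suc M) in A[1+M]
... | true =
  ≤-trans (length≤1+length-filter-≢ (suc M) xs-unique)
          (s≤s (length≤count A M ys (Unique-filter⁺ ≢1+M? xs-unique) ys-bounded))
  where
  ≢1+M? = λ y → ¬? (y ≟ suc M)
  ys = filter ≢1+M? xs
  ys-bounded : All (λ x → A x ≡ true × 1 ≤ x × x ≤ M) ys
  ys-bounded = All.zipWith (λ ((Ax , 1≤x , x≤1+M) , x≢1+M) → Ax , 1≤x , s≤s⁻¹ (≤∧≢⇒< x≤1+M x≢1+M))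
                           (All-filter⁺ ≢1+M? xs-bounded , all-filter ≢1+M? xs)
... | false = length≤count A M xs xs-unique (All.map below xs-bounded)
  where
  below : ∀ {x} → A x ≡ true × 1 ≤ x × x ≤ suc M → A x ≡ true × 1 ≤ x × x ≤ M
  below (Ax , 1≤x , x≤1+M) =
    Ax , 1≤x , s≤s⁻¹ (≤∧≢⇒< x≤1+M λ { refl → contradiction (trans (sym Ax) A[1+M]) λ () })

InTail : Subset → ℕ → ℕ → Set
InTail A n i = (A i ∧ (n ≤ᵇ i)) ≡ true

inTail? : ∀ A n → Decidable (InTail A n)
inTail? A n i = (A i ∧ (n ≤ᵇ i)) ≟ᵇ true

inTail⁻ : ∀ {A n i} → InTail A n i → A i ≡ true × n ≤ i
inTail⁻ {n = n} {i} tail with Equivalence.to T-∧ (Equivalence.from T-≡ tail)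
... | TAi , Tn≤i = Equivalence.to T-≡ TAi , ≤ᵇ⇒≤ n i Tn≤i

positives : ℕ → List ℕ
positives k = map suc (downFrom k)

positives-unique : ∀ k → Unique (positives k)
positives-unique k = Unique-map⁺ suc-injective (downFrom⁺ k)

positives-bounded : ∀ k → All (λ x → 1 ≤ x × x ≤ k) (positives k)
positives-bounded k = All-map⁺ (applyDownFrom⁺₁ _ k λ i<k → s≤s z≤n , i<k)

count≤length-inTail : ∀ A lo k → count A k ≤ length (filter (inTail? A lo) (positives k)) + lo
count≤length-inTail A lo zero = z≤n
count≤length-inTail A lo (suc k) with A (suc k) | lo ≤ᵇ suc k | ≤ᵇ-reflects-≤ lo (suc k)
... | false | _     | _           = count≤length-inTail A lo k
... | true  | true  | ofʸ _       = s≤s (count≤length-inTail A lo k)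
... | true  | false | ofⁿ lo≰1+k = ≤-trans (s≤s (count≤n A k)) (≤-trans (<⇒≤ (≰⇒> lo≰1+k)) (m≤n+m lo _))

large-tailSum : ∀ A M k .{{_ : NonZero k}} → M + M ≤ count A k →
                ∃ λ F → S₁ F × + M ℚ./ k ℚ.≤ tailSum A M F
large-tailSum A M k 2M≤count = F , (F-unique , All.map S₁-bound F-bounded) , lower
  where
  L F : List ℕ
  L = filter (inTail? A M) (positives k)
  F = take M L

  |F|≡M : length F ≡ M
  |F|≡M = trans (length-take M L)
    (m≤n⇒m⊓n≡m (+-cancelʳ-≤ M M (length L) (≤-trans 2M≤count (count≤length-inTail A M k))))

  F-unique : Unique F
  F-unique = Unique-take⁺ M (Unique-filter⁺ (inTail? A M) (positives-unique k))

  F-bounded : All (λ x → InTail A M x × 1 ≤ x × x ≤ k) F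
  F-bounded = All-take⁺ M
    (All.zip (all-filter (inTail? A M) (positives k) , All-filter⁺ (inTail? A M) (positives-bounded k)))

  S₁-bound : ∀ {x} → InTail A M x × 1 ≤ x × x ≤ k → 1 ≤ x × length F ≤ x
  S₁-bound {x} (tail , 1≤x , _) = 1≤x , subst (_≤ x) (sym |F|≡M) (proj₂ (inTail⁻ {A} tail))

  lower : + M ℚ./ k ℚ.≤ tailSum A M F
  lower = begin
    + M ℚ./ k         ≡⟨ cong (λ m → + m ℚ./ k) (sym |F|≡M) ⟩
    + length F ℚ./ k  ≤⟨ length/d≤sumℚ lam k (All.map (λ (_ , 1≤x , x≤k) → 1/k≤lam _ k 1≤x x≤k) F-bounded) ⟩
    sumℚ (map lam F)  ≡⟨ cong (sumℚ ∘ map lam) (sym (filter-all (inTail? A M) (All.map proj₁ F-bounded))) ⟩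
    tailSum A M F     ∎
    where open ℚ.≤-Reasoning

module _ (A : Subset) (q : ℕ) .{{_ : NonZero q}} where

  private instance
    2q≢0 : NonZero (2 * q)
    2q≢0 = m*n≢0 2 q
    4q≢0 : NonZero (4 * q)
    4q≢0 = m*n≢0 4 q

  module _ (n : ℕ) (sparse : ∀ t → n < t → count A t * (16 * q * q) ≤ t) where

    sumℚ-lam≤1/q : ∀ G → Unique G → All (λ x → A x ≡ true × n ≤ x × length G ≤ x) G →
                 sumℚ (map lam G) ℚ.≤ + 1 ℚ./ q
    sumℚ-lam≤1/q [] _ _ = *≤*⇒/≤/ 0 1 1 q z≤n
    sumℚ-lam≤1/q G@(_ ∷ _) G-unique G-bounded =
      ℚ.≤-trans (sumℚ≤sum/d lam w D (All.map (λ (_ , _ , g≤x) → lam≤w/D g≤x) G-bounded))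
                (*≤*⇒/≤/ (sum (map w G)) D 1 q sum-w*q≤D)
      where
      g D c : ℕ
      g = length G
      D = 4 * q * g
      c = length (filter (_<? D) G)

      instance
        D≢0 : NonZero D
        D≢0 = m*n≢0 (4 * q) g

      w : ℕ → ℕ
      w x = if does (x <? D) then 2 * (4 * q) else 2

      lam≤w/D : ∀ {x} → g ≤ x → lam x ℚ.≤ + w x ℚ./ D
      lam≤w/D {x} g≤x = by-size (x <? D)
        where
        by-size : (x<D? : Dec (x < D)) → lam x ℚ.≤ + (if does x<D? then 2 * (4 * q) else 2) ℚ./ D
        by-size (yes _)  = lam≤[2a]/D x (4 * q) D (*-monoʳ-≤ (4 * q) g≤x)
        by-size (no x≮D) = lam≤[2a]/D x 1 D (≤-trans (≮⇒≥ x≮D) (≤-reflexive (sym (*-identityˡ x))))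

      4q*c≤g : 4 * q * c ≤ g
      4q*c≤g with D ≤? n
      ... | yes D≤n
        rewrite filter-none (_<? D) (All.map (λ (_ , n≤x , _) x<D → <⇒≱ x<D (≤-trans D≤n n≤x)) G-bounded)
        = ≤-trans (≤-reflexive (*-zeroʳ (4 * q))) z≤n
      ... | no D≰n = *-cancelʳ-≤ (4 * q * c) g (4 * q) (begin
        4 * q * c * (4 * q)       ≡⟨ solve 2 (λ q c → con 4 :* q :* c :* (con 4 :* q) := c :* (con 16 :* q :* q)) refl q c ⟩
        c * (16 * q * q)          ≤⟨ *-monoˡ-≤ (16 * q * q) (length≤count A D _ (Unique-filter⁺ (_<? D) G-unique) small-bounded) ⟩
        count A D * (16 * q * q)  ≤⟨ sparse D (≰⇒> D≰n) ⟩
        4 * q * g                 ≡⟨ *-comm (4 * q) g ⟩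
        g * (4 * q)               ∎)
        where
        open ≤-Reasoning
        open ℕ-Solver
        small-bounded : All (λ x → A x ≡ true × 1 ≤ x × x ≤ D) (filter (_<? D) G)
        small-bounded = All.zipWith (λ ((Ax , _ , g≤x) , x<D) → Ax , ≤-trans (s≤s z≤n) g≤x , <⇒≤ x<D)
                                    (All-filter⁺ (_<? D) G-bounded , all-filter (_<? D) G)

      sum-w*q≤D : sum (map w G) * q ≤ 1 * D
      sum-w*q≤D = begin
        sum (map w G) * q              ≤⟨ *-monoˡ-≤ q (sum-if-≤ (_<? D) (2 * (4 * q)) 2 G) ⟩
        (2 * (4 * q) * c + 2 * g) * q  ≤⟨ *-monoˡ-≤ q (+-monoˡ-≤ (2 * g) 2*4q*c≤2*g) ⟩
        (2 * g + 2 * g) * q            ≡⟨ solve 2 (λ q g → (con 2 :* g :+ con 2 :* g) :* q := con 1 :* (con 4 :* q :* g)) refl q g ⟩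
        1 * D                          ∎
        where
        open ≤-Reasoning
        open ℕ-Solver
        2*4q*c≤2*g : 2 * (4 * q) * c ≤ 2 * g
        2*4q*c≤2*g = ≤-trans (≤-reflexive (*-assoc 2 (4 * q) c)) (*-monoʳ-≤ 2 4q*c≤g)

    tailSum≤1/q : ∀ F → S₁ F → tailSum A n F ℚ.≤ + 1 ℚ./ q
    tailSum≤1/q F (F-unique , F-bounded) =
      sumℚ-lam≤1/q G (Unique-filter⁺ (inTail? A n) F-unique)
        (All.zipWith G-bounded (All-filter⁺ (inTail? A n) F-bounded , all-filter (inTail? A n) F))
      where
      G = filter (inTail? A n) F
      G-bounded : ∀ {x} → (1 ≤ x × length F ≤ x) × InTail A n x → A x ≡ true × n ≤ x × length G ≤ x
      G-bounded ((_ , |F|≤x) , tail) with inTail⁻ {A} tail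
      ... | Ax , n≤x = Ax , n≤x , ≤-trans (length-filter (inTail? A n) F) |F|≤x

  count*q≤k : ∀ N₀ → (∀ n → N₀ ≤ n → ∀ F → S₁ F → tailSum A n F ℚ.≤ + 1 ℚ./ (4 * q)) →
                ∀ k → suc N₀ * (2 * q) ≤ k → count A k * q ≤ k
  count*q≤k N₀ tail-small k k≥ = ≮⇒≥ dense-impossible
    where
    instance
      k≢0 : NonZero k
      k≢0 = >-nonZero (<-≤-trans (>-nonZero⁻¹ (suc N₀ * (2 * q)) {{m*n≢0 (suc N₀) (2 * q)}}) k≥)

    M : ℕ
    M = k / (2 * q)

    1+N₀≤M : suc N₀ ≤ M
    1+N₀≤M = subst (_≤ M) (m*n/n≡m (suc N₀) (2 * q)) (/-monoˡ-≤ (2 * q) k≥)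

    k<[1+M]*2q : k < suc M * (2 * q)
    k<[1+M]*2q = begin-strict
      k                          ≡⟨ m≡m%n+[m/n]*n k (2 * q) ⟩
      k % (2 * q) + M * (2 * q)  <⟨ +-monoˡ-< (M * (2 * q)) (m%n<n k (2 * q)) ⟩
      2 * q + M * (2 * q)        ∎
      where open ≤-Reasoning

    dense-impossible : ¬ k < count A k * q
    dense-impossible dense = <-irrefl refl (begin-strict
      k                          <⟨ k<[1+M]*2q ⟩
      suc M * (2 * q)            ≡⟨ solve 2 (λ m q → (con 1 :+ m) :* (con 2 :* q) := con 1 :* (con 2 :* q) :+ m :* (con 2 :* q)) refl M q ⟩
      1 * (2 * q) + M * (2 * q)  ≤⟨ +-monoˡ-≤ (M * (2 * q)) (*-monoˡ-≤ (2 * q) (≤-trans (s≤s z≤n) 1+N₀≤M)) ⟩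
      M * (2 * q) + M * (2 * q)  ≡⟨ solve 2 (λ m q → m :* (con 2 :* q) :+ m :* (con 2 :* q) := m :* (con 4 :* q)) refl M q ⟩
      M * (4 * q)                ≤⟨ /≤/⇒*≤* M k 1 (4 * q) M/k≤1/4q ⟩
      1 * k                      ≡⟨ *-identityˡ k ⟩
      k                          ∎)
      where
      open ≤-Reasoning
      open ℕ-Solver
      2M<count : M + M < count A k
      2M<count = *-cancelʳ-< q (M + M) (count A k) (begin-strict
        (M + M) * q    ≡⟨ solve 2 (λ m q → (m :+ m) :* q := m :* (con 2 :* q)) refl M q ⟩
        M * (2 * q)    ≤⟨ m/n*n≤m k (2 * q) ⟩
        k              <⟨ dense ⟩
        count A k * q  ∎)
      M/k≤1/4q : + M ℚ./ k ℚ.≤ + 1 ℚ./ (4 * q)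
      M/k≤1/4q =
        let F , F∈S₁ , M/k≤tail = large-tailSum A M k (<⇒≤ 2M<count)
        in  ℚ.≤-trans M/k≤tail (tail-small M (≤-trans (n≤1+n N₀) 1+N₀≤M) F F∈S₁)

density≤⇒sparse : ∀ A c .{{_ : NonZero c}} N → (∀ n → N ≤ n → density A n ℚ.≤ + 1 ℚ./ c) →
                  ∀ n → N ≤ n → ∀ t → n < t → count A t * c ≤ t
density≤⇒sparse A c N density≤ n N≤n (suc t) n<1+t =
  ≤-trans (/≤/⇒*≤* (count A (suc t)) (suc t) 1 c (density≤ t (≤-trans N≤n (s≤s⁻¹ n<1+t))))
          (≤-reflexive (*-identityˡ (suc t)))

sparse⇒density≤ : ∀ A c .{{_ : NonZero c}} n → count A (suc n) * c ≤ suc n → density A n ℚ.≤ + 1 ℚ./ c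
sparse⇒density≤ A c n sparse =
  *≤*⇒/≤/ (count A (suc n)) (suc n) 1 c (≤-trans sparse (≤-reflexive (sym (*-identityˡ (suc n)))))

Z⇒I₁ : ∀ A → Z A → I₁ A
Z⇒I₁ A zA ε 0<ε =
  let q , 1/q≤ε = ∃1/suc≤ 0<ε
      c = 16 * suc q * suc q
      N , density≤ = zA (+ 1 ℚ./ c) (0<1/ c)
  in  N , λ n N≤n F F∈S₁ →
        ℚ.≤-trans (tailSum≤1/q A (suc q) n (density≤⇒sparse A c N density≤ n N≤n) F F∈S₁) 1/q≤ε

I₁⇒Z : ∀ A → I₁ A → Z A
I₁⇒Z A i₁ ε 0<ε =
  let q , 1/q≤ε = ∃1/suc≤ 0<ε
      N₀ , tail-small = i₁ (+ 1 ℚ./ (4 * suc q)) (0<1/ (4 * suc q))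
  in  suc N₀ * (2 * suc q) , λ n N≤n →
        ℚ.≤-trans (sparse⇒density≤ A (suc q) n
                    (count*q≤k A (suc q) N₀ tail-small (suc n) (m≤n⇒m≤1+n N≤n)))
                  1/q≤ε

proposition8p1 : ∀ (A : Subset) → I₁ A ⇔ Z A
proposition8p1 A = mk⇔ (I₁⇒Z A) (Z⇒I₁ A)
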